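{- Let $T=T(P,R)$ be a path diagram with $P=(b_1,\dots,b_N)$ and $R=(r_1,\dots,r_N)$ which is increasing (i.e. $r_1\le r_2\le\dots\le r_N$) and balanced. Then $P$ is a general Dyck path, i.e. $b_1+\cdots+b_N=0$ and $b_1+\cdots+b_{i-1}\ge0$ for all $1\le i\le N$.
   Context: A path diagram $T(P,R)$ consists of arrows $A_i$, the vector $(1,b_i)$ from $(i,r_i)$ to $(i+1,r_i+b_i)$. $A_i$ is red if $b_i>0$, blue if $b_i<0$. Row $j$ is the strip between heights $j$ and $j+1$; a red arrow has a segment in row $j$ iff $r_i\le j\le r_i+b_i-1$, a blue arrow iff $r_i+b_i\le j\le r_i-1$. The row count $c(j)$ is the number of red segments minus the number of blue segments in row $j$; $T$ is balanced if $c(j)=0$ for all $j$. The sequence $P$ is called the V-path of $T$. -}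

module Defs where

open import Data.Nat using (ℕ)
open import Data.Integer using (ℤ; _+_; _-_; _≤_; _<_; +_; 0ℤ; 1ℤ)
open import Data.Integer.Properties using (_≤?_; _<?_)
open import Data.Fin using (Fin; toℕ; _<_)
open import Data.Product using (_×_)
open import Relation.Nullary using (¬_)
open import Relation.Nullary.Decidable using (Dec; _×-dec_; does)
open import Relation.Binary.PropositionalEquality using (_≡_)
open import Data.Bool using (if_then_else_)
open import Data.List using (List; map; allFin; foldr)
open import Data.Nat.ListAction using (sum)

-- A path diagram T(P,R) with N arrows: P = (b_1..b_N), R = (r_1..r_N),
-- indexed by Fin N (index i : Fin N stands for arrow A_{i+1}).
-- Arrows are red (b > 0) or blue (b < 0), so every b_i is nonzero.
record PathDiagram (N : ℕ) : Set where
  field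
    b : Fin N → ℤ
    r : Fin N → ℤ
    b≢0 : ∀ i → ¬ (b i ≡ 0ℤ)
open PathDiagram public

redSeg : ∀ {N} → PathDiagram N → Fin N → ℤ → Set
redSeg T i j = (0ℤ Data.Integer.< b T i) × (r T i ≤ j) × (j ≤ r T i + b T i - 1ℤ)

blueSeg : ∀ {N} → PathDiagram N → Fin N → ℤ → Set
blueSeg T i j = (b T i Data.Integer.< 0ℤ) × (r T i + b T i ≤ j) × (j ≤ r T i - 1ℤ)

redSeg? : ∀ {N} (T : PathDiagram N) i j → Dec (redSeg T i j)
redSeg? T i j = (0ℤ <? b T i) ×-dec ((r T i ≤? j) ×-dec (j ≤? r T i + b T i - 1ℤ))

blueSeg? : ∀ {N} (T : PathDiagram N) i j → Dec (blueSeg T i j)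
blueSeg? T i j = (b T i <? 0ℤ) ×-dec ((r T i + b T i ≤? j) ×-dec (j ≤? r T i - 1ℤ))

countDec : ∀ {N} {P : Fin N → Set} → ((i : Fin N) → Dec (P i)) → ℕ
countDec {N} P? = sum (map (λ i → if does (P? i) then 1 else 0) (allFin N))

rowCount : ∀ {N} → PathDiagram N → ℤ → ℤ
rowCount T j = + countDec (λ i → redSeg? T i j) - + countDec (λ i → blueSeg? T i j)

Balanced : ∀ {N} → PathDiagram N → Set
Balanced T = ∀ j → rowCount T j ≡ 0ℤ

Increasing : ∀ {N} → PathDiagram N → Set
Increasing {N} T = ∀ (i k : Fin N) → i Data.Fin.< k → r T i ≤ r T k

prefixSum : ∀ {N} → PathDiagram N → ℕ → ℤ
prefixSum {N} T m = sumℤ (map (λ i → if does (toℕ i Data.Nat.<? m) then b T i else 0ℤ) (allFin N))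
  where
    open import Data.Nat using (_<?_)
    sumℤ : List ℤ → ℤ
    sumℤ = foldr _+_ 0ℤ

GeneralDyck : ∀ {N} → PathDiagram N → Set
GeneralDyck {N} T = (prefixSum T N ≡ 0ℤ) × (∀ (i : Fin N) → 0ℤ ≤ prefixSum T (toℕ i))

-- Let φ_i(h) = (r_i + b_i) ⊓ h − r_i ⊓ h be the signed vertical extent of arrow A_i
-- below level h.  Raising h by one changes Σ_i φ_i(h) by exactly the row count c(h), so
-- in a balanced diagram this sum does not depend on h.  Below every arrow it is 0, and
-- above every arrow it is b_1 + … + b_N.  At level h = r_m, since R is increasing, each
-- arrow before A_m contributes at most b_i and every other arrow at most 0, whence
-- b_1 + … + b_{m-1} ≥ Σ_i φ_i(r_m) = 0.
module Submission where

open import Defs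
open import Data.Nat using (ℕ; zero; suc)
import Data.Nat as ℕ
open import Data.Integer
  using (ℤ; _+_; _-_; -_; +_; 0ℤ; 1ℤ; -1ℤ; -[1+_]; _≤_; _<_; _⊓_; _⊔_)
  renaming (suc to sucℤ)
open import Data.Integer.Properties
open import Data.Integer.Tactic.RingSolver using (solve-∀)
open import Algebra.Properties.CommutativeSemigroup +-commutativeSemigroup using (interchange)
open import Algebra.Properties.AbelianGroup +-0-abelianGroup using (xyx⁻¹≈y)
open import Data.Bool using (if_then_else_)
open import Data.Fin using (Fin; toℕ) renaming (zero to fzero; suc to fsuc)
import Data.Fin.Properties as Finₚ
open import Data.List using (List; []; _∷_; map; foldr; allFin)
open import Data.List.Properties using (map-cong)
open import Data.Nat.ListAction using (sum)
open import Data.Product using (_,_; ∃-syntax)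
open import Data.Empty using (⊥-elim)
open import Relation.Nullary using (¬_; Dec; yes; no; does; _×-dec_)
open import Relation.Binary.Definitions using (tri<; tri≈; tri>)
open import Relation.Binary.PropositionalEquality
open ≡-Reasoning

indicator : ∀ {p} {P : Set p} → Dec P → ℕ
indicator d = if does d then 1 else 0

if-does-yes : ∀ {a p} {A : Set a} {P : Set p} (d : Dec P) {x y : A} → P → (if does d then x else y) ≡ x
if-does-yes (yes _) _ = refl
if-does-yes (no ¬p) p = ⊥-elim (¬p p)

if-does-no : ∀ {a p} {A : Set a} {P : Set p} (d : Dec P) {x y : A} → ¬ P → (if does d then x else y) ≡ y
if-does-no (yes p) ¬p = ⊥-elim (¬p p)
if-does-no (no _) _ = refl

indicator-×-yes : ∀ {p q} {P : Set p} {Q : Set q} (d : Dec P) (e : Dec Q) →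
                  P → indicator (d ×-dec e) ≡ indicator e
indicator-×-yes (yes _) e _ = refl
indicator-×-yes (no ¬p) e p = ⊥-elim (¬p p)

sumℤ : List ℤ → ℤ
sumℤ = foldr _+_ 0ℤ

module _ {a} {A : Set a} where

  sumℤ-map-+ : ∀ (f g : A → ℤ) xs →
               sumℤ (map (λ x → f x + g x) xs) ≡ sumℤ (map f xs) + sumℤ (map g xs)
  sumℤ-map-+ f g []       = refl
  sumℤ-map-+ f g (x ∷ xs) = begin
    (f x + g x) + sumℤ (map (λ x → f x + g x) xs)      ≡⟨ cong (_+_ (f x + g x)) (sumℤ-map-+ f g xs) ⟩
    (f x + g x) + (sumℤ (map f xs) + sumℤ (map g xs))  ≡⟨ interchange (f x) (g x) _ _ ⟩
    (f x + sumℤ (map f xs)) + (g x + sumℤ (map g xs))  ∎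

  sumℤ-map-neg : ∀ (f : A → ℤ) xs → sumℤ (map (λ x → - f x) xs) ≡ - sumℤ (map f xs)
  sumℤ-map-neg f []       = refl
  sumℤ-map-neg f (x ∷ xs) = begin
    - f x + sumℤ (map (λ x → - f x) xs)  ≡⟨ cong (_+_ (- f x)) (sumℤ-map-neg f xs) ⟩
    - f x + - sumℤ (map f xs)            ≡⟨ neg-distrib-+ (f x) _ ⟨
    - (f x + sumℤ (map f xs))            ∎

  sumℤ-map-− : ∀ (f g : A → ℤ) xs →
               sumℤ (map (λ x → f x - g x) xs) ≡ sumℤ (map f xs) - sumℤ (map g xs)
  sumℤ-map-− f g xs = trans (sumℤ-map-+ f (λ x → - g x) xs)
                            (cong (_+_ (sumℤ (map f xs))) (sumℤ-map-neg g xs))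

  sum-map-pos : ∀ (u : A → ℕ) xs → + sum (map u xs) ≡ sumℤ (map (λ x → + u x) xs)
  sum-map-pos u []       = refl
  sum-map-pos u (x ∷ xs) = trans (pos-+ (u x) _) (cong (_+_ (+ u x)) (sum-map-pos u xs))

  sumℤ-map-mono : ∀ {f g : A → ℤ} → (∀ x → f x ≤ g x) → ∀ xs →
                  sumℤ (map f xs) ≤ sumℤ (map g xs)
  sumℤ-map-mono f≤g []       = ≤-refl
  sumℤ-map-mono f≤g (x ∷ xs) = +-mono-≤ (f≤g x) (sumℤ-map-mono f≤g xs)

  sumℤ-map-zero : ∀ {f : A → ℤ} → (∀ x → f x ≡ 0ℤ) → ∀ xs → sumℤ (map f xs) ≡ 0ℤ
  sumℤ-map-zero f≡0 []       = refl
  sumℤ-map-zero f≡0 (x ∷ xs) = cong₂ _+_ (f≡0 x) (sumℤ-map-zero f≡0 xs)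

lowerBound : ∀ {n} (f : Fin n → ℤ) → ∃[ L ] (∀ i → L ≤ f i)
lowerBound {zero}  f = 0ℤ , λ ()
lowerBound {suc n} f with lowerBound (λ i → f (fsuc i))
... | L , L≤f = f fzero ⊓ L , λ where
  fzero    → i⊓j≤i _ _
  (fsuc i) → ≤-trans (i⊓j≤j _ _) (L≤f i)

upperBound : ∀ {n} (f : Fin n → ℤ) → ∃[ H ] (∀ i → f i ≤ H)
upperBound f with lowerBound (λ i → - f i)
... | L , L≤-f = - L , λ i → subst (_≤ - L) (neg-involutive (f i)) (neg-mono-≤ (L≤-f i))

suc-invariant⇒constant : (f : ℤ → ℤ) → (∀ h → f (sucℤ h) ≡ f h) → ∀ h h' → f h ≡ f h'
suc-invariant⇒constant f step h h' = trans (≡f0 h) (sym (≡f0 h'))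
  where
    ≡f0 : ∀ h → f h ≡ f 0ℤ
    ≡f0 (+ zero)        = refl
    ≡f0 (+ suc n)       = trans (step (+ n)) (≡f0 (+ n))
    ≡f0 -[1+ zero ]     = sym (step -1ℤ)
    ≡f0 -[1+ suc n ]    = trans (sym (step -[1+ suc n ])) (≡f0 -[1+ n ])

i≤j-1⇒i<j : ∀ {i j} → i ≤ j - 1ℤ → i < j
i≤j-1⇒i<j {i} {j} p = i≤pred[j]⇒i<j (subst (i ≤_) (+-comm j -1ℤ) p)

i<j⇒i≤j-1 : ∀ {i j} → i < j → i ≤ j - 1ℤ
i<j⇒i≤j-1 {i} {j} p = subst (i ≤_) (+-comm -1ℤ j) (i<j⇒i≤pred[j] p)

0≤j⇒i≤i+j : ∀ {i j} → 0ℤ ≤ j → i ≤ i + j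
0≤j⇒i≤i+j {i} {j} 0≤j = subst (_≤ i + j) (+-identityʳ i) (+-monoʳ-≤ i 0≤j)

j≤0⇒i+j≤i : ∀ {i j} → j ≤ 0ℤ → i + j ≤ i
j≤0⇒i+j≤i {i} {j} j≤0 = subst (i + j ≤_) (+-identityʳ i) (+-monoʳ-≤ i j≤0)

interval-indicator : ∀ {lo hi} h → lo ≤ hi →
  + indicator ((lo ≤? h) ×-dec (h ≤? hi - 1ℤ)) ≡ + indicator (h <? hi) - + indicator (h <? lo)
interval-indicator {lo} {hi} h lo≤hi with h <? lo | h <? hi
... | yes h<lo | yes _    = cong +_ (if-does-no inside? λ (lo≤h , _) → <⇒≱ h<lo lo≤h)
  where inside? = (lo ≤? h) ×-dec (h ≤? hi - 1ℤ)
... | yes h<lo | no h≮hi  = ⊥-elim (h≮hi (<-≤-trans h<lo lo≤hi))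
... | no h≮lo  | yes h<hi = cong +_ (if-does-yes inside? (≮⇒≥ h≮lo , i<j⇒i≤j-1 h<hi))
  where inside? = (lo ≤? h) ×-dec (h ≤? hi - 1ℤ)
... | no _     | no h≮hi  = cong +_ (if-does-no inside? λ (_ , h≤) → h≮hi (i≤j-1⇒i<j h≤))
  where inside? = (lo ≤? h) ×-dec (h ≤? hi - 1ℤ)

rise : ℤ → ℤ → ℤ → ℤ
rise x y h = y ⊓ h - x ⊓ h

⊓-suc : ∀ x h → x ⊓ sucℤ h ≡ x ⊓ h + + indicator (h <? x)
⊓-suc x h with h <? x
... | yes h<x = begin
  x ⊓ sucℤ h  ≡⟨ i≥j⇒i⊓j≡j (i<j⇒suc[i]≤j h<x) ⟩
  1ℤ + h      ≡⟨ +-comm 1ℤ h ⟩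
  h + 1ℤ      ≡⟨ cong (_+ 1ℤ) (i≥j⇒i⊓j≡j (<⇒≤ h<x)) ⟨
  x ⊓ h + 1ℤ  ∎
... | no h≮x = begin
  x ⊓ sucℤ h  ≡⟨ i≤j⇒i⊓j≡i (≤-trans (≮⇒≥ h≮x) (i≤suc[i] h)) ⟩
  x           ≡⟨ i≤j⇒i⊓j≡i (≮⇒≥ h≮x) ⟨
  x ⊓ h       ≡⟨ +-identityʳ (x ⊓ h) ⟨
  x ⊓ h + 0ℤ  ∎

rise-suc : ∀ x y h → rise x y (sucℤ h) ≡ rise x y h + (+ indicator (h <? y) - + indicator (h <? x))
rise-suc x y h rewrite ⊓-suc y h | ⊓-suc x h =
  regroup (y ⊓ h) (+ indicator (h <? y)) (x ⊓ h) (+ indicator (h <? x))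
  where
    regroup : ∀ a p c q → (a + p) - (c + q) ≡ (a - c) + (p - q)
    regroup = solve-∀

rise≡0 : ∀ {x y h} → h ≤ x → h ≤ y → rise x y h ≡ 0ℤ
rise≡0 {x} {y} {h} h≤x h≤y rewrite i≥j⇒i⊓j≡j h≤x | i≥j⇒i⊓j≡j h≤y = +-inverseʳ h

rise≡y-x : ∀ {x y h} → x ≤ h → y ≤ h → rise x y h ≡ y - x
rise≡y-x x≤h y≤h rewrite i≤j⇒i⊓j≡i x≤h | i≤j⇒i⊓j≡i y≤h = refl

rise≤y-x : ∀ {x h} y → x ≤ h → rise x y h ≤ y - x
rise≤y-x {x} {h} y x≤h rewrite i≤j⇒i⊓j≡i x≤h = +-monoˡ-≤ (- x) (i⊓j≤i y h)

rise≤0 : ∀ {x h} y → h ≤ x → rise x y h ≤ 0ℤ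
rise≤0 {x} {h} y h≤x rewrite i≥j⇒i⊓j≡j h≤x = i≤j⇒i-j≤0 (i⊓j≤j y h)

module _ {N : ℕ} (T : PathDiagram N) where

  arrowRise : Fin N → ℤ → ℤ
  arrowRise i = rise (r T i) (r T i + b T i)

  levelSum : ℤ → ℤ
  levelSum h = sumℤ (map (λ i → arrowRise i h) (allFin N))

  rowContribution : Fin N → ℤ → ℤ
  rowContribution i j = + indicator (redSeg? T i j) - + indicator (blueSeg? T i j)

  rise-jump≡rowContribution : ∀ i h →
    + indicator (h <? r T i + b T i) - + indicator (h <? r T i) ≡ rowContribution i h
  rise-jump≡rowContribution i h with <-cmp 0ℤ (b T i)
  ... | tri< 0<b _ b≮0 = sym (begin
    + indicator (redSeg? T i h) - + indicator (blueSeg? T i h)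
      ≡⟨ cong₂ (λ u v → + u - + v)
               (indicator-×-yes (0ℤ <? b T i) ((r T i ≤? h) ×-dec (h ≤? r T i + b T i - 1ℤ)) 0<b)
               (if-does-no (blueSeg? T i h) λ (b<0 , _) → b≮0 b<0) ⟩
    + indicator ((r T i ≤? h) ×-dec (h ≤? r T i + b T i - 1ℤ)) - 0ℤ
      ≡⟨ +-identityʳ _ ⟩
    + indicator ((r T i ≤? h) ×-dec (h ≤? r T i + b T i - 1ℤ))
      ≡⟨ interval-indicator h (0≤j⇒i≤i+j (<⇒≤ 0<b)) ⟩
    + indicator (h <? r T i + b T i) - + indicator (h <? r T i)  ∎)
  ... | tri≈ _ 0≡b _ = begin
    + indicator (h <? r T i + b T i) - + indicator (h <? r T i)
      ≡⟨ cong (λ y → + indicator (h <? y) - + indicator (h <? r T i)) r+b≡r ⟩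
    + indicator (h <? r T i) - + indicator (h <? r T i)
      ≡⟨ +-inverseʳ (+ indicator (h <? r T i)) ⟩
    0ℤ
      ≡⟨ cong₂ (λ u v → + u - + v)
               (if-does-no (redSeg? T i h) λ (0<b , _) → <-irrefl 0≡b 0<b)
               (if-does-no (blueSeg? T i h) λ (b<0 , _) → <-irrefl (sym 0≡b) b<0) ⟨
    rowContribution i h  ∎
    where
      r+b≡r : r T i + b T i ≡ r T i
      r+b≡r = trans (cong (_+_ (r T i)) (sym 0≡b)) (+-identityʳ (r T i))
  ... | tri> _ _ b<0 = sym (begin
    + indicator (redSeg? T i h) - + indicator (blueSeg? T i h)
      ≡⟨ cong₂ (λ u v → + u - + v)
               (if-does-no (redSeg? T i h) λ (0<b , _) → <-asym 0<b b<0)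
               (indicator-×-yes (b T i <? 0ℤ) ((r T i + b T i ≤? h) ×-dec (h ≤? r T i - 1ℤ)) b<0) ⟩
    0ℤ - + indicator ((r T i + b T i ≤? h) ×-dec (h ≤? r T i - 1ℤ))
      ≡⟨ cong (_-_ 0ℤ) (interval-indicator h (j≤0⇒i+j≤i (<⇒≤ b<0))) ⟩
    0ℤ - (+ indicator (h <? r T i) - + indicator (h <? r T i + b T i))
      ≡⟨ negate-difference (+ indicator (h <? r T i)) (+ indicator (h <? r T i + b T i)) ⟩
    + indicator (h <? r T i + b T i) - + indicator (h <? r T i)  ∎)
    where
      negate-difference : ∀ p q → 0ℤ - (p - q) ≡ q - p
      negate-difference = solve-∀

  arrowRise-suc : ∀ i h → arrowRise i (sucℤ h) ≡ arrowRise i h + rowContribution i h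
  arrowRise-suc i h = trans (rise-suc (r T i) (r T i + b T i) h)
                            (cong (_+_ (arrowRise i h)) (rise-jump≡rowContribution i h))

  rowCount≡sum-rowContribution : ∀ h → rowCount T h ≡ sumℤ (map (λ i → rowContribution i h) (allFin N))
  rowCount≡sum-rowContribution h = sym (begin
    sumℤ (map (λ i → rowContribution i h) (allFin N))
      ≡⟨ sumℤ-map-− (λ i → + red i) (λ i → + blue i) (allFin N) ⟩
    sumℤ (map (λ i → + red i) (allFin N)) - sumℤ (map (λ i → + blue i) (allFin N))
      ≡⟨ cong₂ _-_ (sum-map-pos red (allFin N)) (sum-map-pos blue (allFin N)) ⟨
    rowCount T h  ∎)
    where
      red blue : Fin N → ℕ
      red  i = indicator (redSeg? T i h)
      blue i = indicator (blueSeg? T i h)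

  levelSum-suc : ∀ h → levelSum (sucℤ h) ≡ levelSum h + rowCount T h
  levelSum-suc h = begin
    levelSum (sucℤ h)
      ≡⟨ cong sumℤ (map-cong (λ i → arrowRise-suc i h) (allFin N)) ⟩
    sumℤ (map (λ i → arrowRise i h + rowContribution i h) (allFin N))
      ≡⟨ sumℤ-map-+ (λ i → arrowRise i h) (λ i → rowContribution i h) (allFin N) ⟩
    levelSum h + sumℤ (map (λ i → rowContribution i h) (allFin N))
      ≡⟨ cong (_+_ (levelSum h)) (rowCount≡sum-rowContribution h) ⟨
    levelSum h + rowCount T h  ∎

  levelSum-below : ∀ {L} → (∀ i → L ≤ r T i ⊓ (r T i + b T i)) → levelSum L ≡ 0ℤ
  levelSum-below L≤ = sumℤ-map-zero (λ i → rise≡0 (≤-trans (L≤ i) (i⊓j≤i _ _))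
                                                       (≤-trans (L≤ i) (i⊓j≤j _ _))) (allFin N)

  levelSum-above : ∀ {H} → (∀ i → r T i ⊔ (r T i + b T i) ≤ H) → levelSum H ≡ prefixSum T N
  levelSum-above {H} ≤H = cong sumℤ (map-cong arrowRise≡b (allFin N))
    where
      arrowRise≡b : ∀ i → arrowRise i H ≡ (if does (toℕ i ℕ.<? N) then b T i else 0ℤ)
      arrowRise≡b i with toℕ i ℕ.<? N
      ... | yes i<N = begin
        arrowRise i H  ≡⟨ rise≡y-x (≤-trans (i≤i⊔j _ _) (≤H i)) (≤-trans (i≤j⊔i _ _) (≤H i)) ⟩
        (r T i + b T i) - r T i  ≡⟨ xyx⁻¹≈y (r T i) (b T i) ⟩
        b T i  ≡⟨ if-does-yes (toℕ i ℕ.<? N) i<N ⟨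
        (if does (toℕ i ℕ.<? N) then b T i else 0ℤ)  ∎
      ... | no i≮N = ⊥-elim (i≮N (Finₚ.toℕ<n i))

  levelSum-vanishes : Balanced T → ∀ h → levelSum h ≡ 0ℤ
  levelSum-vanishes balanced h with lowerBound (λ i → r T i ⊓ (r T i + b T i))
  ... | L , L≤ = trans (suc-invariant⇒constant levelSum suc-invariant h L) (levelSum-below L≤)
    where
      suc-invariant : ∀ h → levelSum (sucℤ h) ≡ levelSum h
      suc-invariant h = begin
        levelSum (sucℤ h)          ≡⟨ levelSum-suc h ⟩
        levelSum h + rowCount T h  ≡⟨ cong (_+_ (levelSum h)) (balanced h) ⟩
        levelSum h + 0ℤ            ≡⟨ +-identityʳ (levelSum h) ⟩
        levelSum h                 ∎

  increasing-≮⇒≤ : Increasing T → ∀ {i k} → ¬ (toℕ k ℕ.< toℕ i) → r T i ≤ r T k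
  increasing-≮⇒≤ increasing {i} {k} k≮i with Finₚ.<-cmp i k
  ... | tri< i<k _ _    = increasing i k i<k
  ... | tri≈ _ refl _   = ≤-refl
  ... | tri> _ _ k<i    = ⊥-elim (k≮i k<i)

  levelSum-≤-prefixSum : Increasing T → ∀ m → levelSum (r T m) ≤ prefixSum T (toℕ m)
  levelSum-≤-prefixSum increasing m = sumℤ-map-mono arrowRise≤ (allFin N)
    where
      arrowRise≤ : ∀ k → arrowRise k (r T m) ≤ (if does (toℕ k ℕ.<? toℕ m) then b T k else 0ℤ)
      arrowRise≤ k with toℕ k ℕ.<? toℕ m
      ... | yes k<m = ≤-trans (rise≤y-x (r T k + b T k) (increasing k m k<m))
                              (≤-reflexive (trans (xyx⁻¹≈y (r T k) (b T k))
                                                  (sym (if-does-yes (toℕ k ℕ.<? toℕ m) k<m))))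
      ... | no k≮m  = ≤-trans (rise≤0 (r T k + b T k) (increasing-≮⇒≤ increasing k≮m))
                              (≤-reflexive (sym (if-does-no (toℕ k ℕ.<? toℕ m) k≮m)))

proposition2 : (N : ℕ) (T : PathDiagram N) → Increasing T → Balanced T → GeneralDyck T
proposition2 N T increasing balanced = total , prefixes
  where
    total : prefixSum T N ≡ 0ℤ
    total with upperBound (λ i → r T i ⊔ (r T i + b T i))
    ... | H , ≤H = trans (sym (levelSum-above T ≤H)) (levelSum-vanishes T balanced H)

    prefixes : ∀ m → 0ℤ ≤ prefixSum T (toℕ m)
    prefixes m = subst (_≤ prefixSum T (toℕ m)) (levelSum-vanishes T balanced (r T m))
                       (levelSum-≤-prefixSum T increasing m)
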